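{- For any permutation $\pi$ of length $n$, we have $|D(\pi)| \le n$, where $D(\pi)=\{(r,s)\in\mathbb N^2 : \pi \text{ is not } (r,s)\text{ -coverable}\}$.
   Context: A permutation of length $n\ge 0$ is a bijection $\pi$ of $[n]=\{1,\dots,n\}$, written as the sequence $\pi(1)\,\pi(2)\ldots\pi(n)$. $\mathbb N=\{0,1,2,\dots\}$. For $r,s\in\mathbb N$, $\pi$ is $(r,s)$-coverable if the terms of $\pi$ can be partitioned into $r$ increasing subsequences and $s$ decreasing subsequences (subsequences are allowed to be empty). -}

module Defs where

open import Data.Nat using (ℕ)
open import Data.Fin using (Fin; _<_)
open import Data.Fin.Permutation using (Permutation′; _⟨$⟩ʳ_)
open import Data.Sum using (_⊎_; inj₁; inj₂)
open import Data.Product using (Σ; _×_; _,_)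
open import Relation.Binary.PropositionalEquality using (_≡_)
open import Relation.Nullary using (¬_)

-- A permutation of length n: a bijection of Fin n (positions/values 0..n-1,
-- i.e. [n] shifted by one).  π(i) is  π ⟨$⟩ʳ i.

-- Colour classes
-- may be empty.
IsCovering : {n : ℕ} → Permutation′ n → (r s : ℕ) → (Fin n → Fin r ⊎ Fin s) → Set
IsCovering {n} π r s c =
  (∀ (i j : Fin n) (k : Fin r) → c i ≡ inj₁ k → c j ≡ inj₁ k → i < j →
     (π ⟨$⟩ʳ i) < (π ⟨$⟩ʳ j))
  × (∀ (i j : Fin n) (k : Fin s) → c i ≡ inj₂ k → c j ≡ inj₂ k → i < j →
     (π ⟨$⟩ʳ j) < (π ⟨$⟩ʳ i))

Coverable : {n : ℕ} → Permutation′ n → ℕ → ℕ → Set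
Coverable {n} π r s = Σ (Fin n → Fin r ⊎ Fin s) (λ c → IsCovering π r s c)

InD : {n : ℕ} → Permutation′ n → ℕ × ℕ → Set
InD π (r , s) = ¬ Coverable π r s

-- By Mirsky's theorem, ranking each letter by the length of a longest decreasing
-- subsequence starting at it shows that π is (ℓ , 0)-coverable, where ℓ is the
-- length of some decreasing subsequence C.  Hence (r , 0) ∈ D(π) forces r < ℓ.
-- Moreover C can serve as an extra decreasing class, so (r , s + 1) ∈ D(π) forces
-- (r , s) ∈ D(π ∖ C).  Induction on the length gives |D(π)| ≤ ℓ + (n − ℓ) = n.
module Submission where

open import Defs
open import Data.Bool using (Bool; true; false; not; T; if_then_else_)
open import Data.Empty using (⊥-elim)
open import Data.Fin as Fin using (Fin; toℕ; fromℕ<)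
open import Data.Fin.Permutation using (Permutation′; _⟨$⟩ʳ_; _⟨$⟩ˡ_; inverseˡ)
open import Data.Fin.Properties using (toℕ-injective; toℕ-fromℕ<; injective⇒≤)
open import Data.List using (List; []; _∷_; length; filterᵇ; tabulate; lookup)
open import Data.List.Properties using (length-tabulate; filter-accept; filter-reject)
open import Data.List.Membership.Propositional using (_∈_)
open import Data.List.Membership.Propositional.Properties using (∈-lookup)
open import Data.List.Relation.Unary.All as All using (All; []; _∷_)
open import Data.List.Relation.Unary.All.Properties using (tabulate⁻)
open import Data.List.Relation.Unary.AllPairs as AllPairs using (AllPairs; []; _∷_)
open import Data.List.Relation.Unary.Any using (here; there)
open import Data.List.Relation.Unary.Unique.Propositional using (Unique)
import Data.List.Relation.Unary.Unique.Propositional.Properties as Unique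
open import Data.Nat using (ℕ; zero; suc; _+_; _≤_; _<_; z≤n; s≤s; _≟_; _≤?_; _<?_)
open import Data.Nat.Induction using (<-wellFounded)
open import Data.Nat.Properties
open import Data.Product using (∃; _×_; _,_)
open import Data.Sum using (_⊎_; inj₁; inj₂)
open import Data.Unit using (⊤; tt)
open import Function using (_∘_)
open import Induction.WellFounded using (Acc; acc)
open import Relation.Binary.PropositionalEquality
open import Relation.Nullary using (¬_; yes; no)
open import Relation.Nullary.Decidable using (T?)
open import Relation.Unary using (Decidable)

length-filterᵇ-split : ∀ {A : Set} (P : A → Bool) xs →
  length (filterᵇ P xs) + length (filterᵇ (not ∘ P) xs) ≡ length xs
length-filterᵇ-split P [] = refl
length-filterᵇ-split P (x ∷ xs) with P x
... | true  = cong suc (length-filterᵇ-split P xs)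
... | false = trans (+-suc _ _) (cong suc (length-filterᵇ-split P xs))

All-filterᵇ⁻ : ∀ {A : Set} {Q : A → Set} (P : A → Bool) xs →
  All Q (filterᵇ P xs) → All (λ u → T (P u) → Q u) xs
All-filterᵇ⁻ P [] [] = []
All-filterᵇ⁻ P (x ∷ xs) qs with P x in px
... | true  = (λ _ → All.head qs) ∷ All-filterᵇ⁻ P xs (All.tail qs)
... | false = (λ t → ⊥-elim (subst T px t)) ∷ All-filterᵇ⁻ P xs qs

filterᵇ-congOn : ∀ {A : Set} {P Q : A → Bool} {xs} →
  All (λ u → P u ≡ Q u) xs → filterᵇ P xs ≡ filterᵇ Q xs
filterᵇ-congOn [] = refl
filterᵇ-congOn {P = P} {Q} {x ∷ xs} (e ∷ es) with P x | Q x | e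
... | true  | .true  | refl = cong (x ∷_) (filterᵇ-congOn es)
... | false | .false | refl = filterᵇ-congOn es

All-congOn : ∀ {A B : Set} {Q : B → A → Set} {f g : A → B} {xs} →
  All (λ u → f u ≡ g u) xs → All (λ u → Q (f u) u) xs → All (λ u → Q (g u) u) xs
All-congOn {Q = Q} f≗g qs = All.zipWith (λ (e , q) → subst (λ c → Q c _) e q) (f≗g , qs)

AllPairs-congOn : ∀ {A B : Set} {R : B → B → A → A → Set} {f g : A → B} {xs} →
  All (λ u → f u ≡ g u) xs →
  AllPairs (λ a b → R (f a) (f b) a b) xs → AllPairs (λ a b → R (g a) (g b) a b) xs
AllPairs-congOn [] [] = []
AllPairs-congOn {R = R} {f} {g} (e ∷ f≗g) (rs ∷ rss) =
  All.zipWith (λ (e′ , r) → subst₂ (λ c d → R c d _ _) e e′ r) (f≗g , rs)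
  ∷ AllPairs-congOn {R = R} {f} {g} f≗g rss

AllPairs-tabulate⁻ : ∀ {A : Set} {R : A → A → Set} {n} {f : Fin n → A} →
  AllPairs R (tabulate f) → ∀ {i j} → i Fin.< j → R (f i) (f j)
AllPairs-tabulate⁻ (r ∷ _)  {Fin.zero}  {Fin.suc j} _         = tabulate⁻ r j
AllPairs-tabulate⁻ (_ ∷ rs) {Fin.suc i} {Fin.suc j} (s≤s i<j) = AllPairs-tabulate⁻ rs i<j

maximiser : ∀ {A : Set} {P : A → Set} → Decidable P → (f : A → ℕ) → ∀ xs →
  All (¬_ ∘ P) xs ⊎ ∃ λ y → y ∈ xs × P y × All (λ b → P b → f b ≤ f y) xs
maximiser P? f [] = inj₁ []
maximiser P? f (z ∷ zs) with P? z | maximiser P? f zs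
... | no ¬pz | inj₁ none = inj₁ (¬pz ∷ none)
... | no ¬pz | inj₂ (y , y∈ , py , max) = inj₂ (y , there y∈ , py , (⊥-elim ∘ ¬pz) ∷ max)
... | yes pz | inj₁ none =
  inj₂ (z , here refl , pz , (λ _ → ≤-refl) ∷ All.map (λ ¬pb pb → ⊥-elim (¬pb pb)) none)
... | yes pz | inj₂ (y , y∈ , py , max) with f z ≤? f y
...   | yes fz≤fy = inj₂ (y , there y∈ , py , (λ _ → fz≤fy) ∷ max)
...   | no fz≰fy  = inj₂ (z , here refl , pz , (λ _ → ≤-refl) ∷ All.map (λ fb≤fy pb → ≤-trans (fb≤fy pb) fy≤fz) max)
  where
  fy≤fz : f y ≤ f z
  fy≤fz = <⇒≤ (≰⇒> fz≰fy)

lookup-injective : ∀ {A : Set} {xs : List A} → Unique xs →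
  ∀ {i j} → lookup xs i ≡ lookup xs j → i ≡ j
lookup-injective (_  ∷ _)   {Fin.zero}  {Fin.zero}  _ = refl
lookup-injective (x∉ ∷ _)   {Fin.zero}  {Fin.suc j} e = ⊥-elim (All.lookup x∉ (∈-lookup j) e)
lookup-injective (x∉ ∷ _)   {Fin.suc i} {Fin.zero}  e = ⊥-elim (All.lookup x∉ (∈-lookup i) (sym e))
lookup-injective (_  ∷ xs!) {Fin.suc i} {Fin.suc j} e = cong Fin.suc (lookup-injective xs! e)

length-unique-bounded : ∀ {ℓ xs} → Unique xs → All (_< ℓ) xs → length xs ≤ ℓ
length-unique-bounded {ℓ} {xs} xs! bounded = injective⇒≤ {f = index} (λ e →
  lookup-injective xs! (trans (sym (toℕ-fromℕ< _)) (trans (cong toℕ e) (toℕ-fromℕ< _))))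
  where
  index : Fin (length xs) → Fin ℓ
  index i = fromℕ< (All.lookup bounded (∈-lookup i))

_[_≔_] : {A : Set} → (ℕ → A) → ℕ → A → ℕ → A
(f [ x ≔ a ]) u with u ≟ x
... | yes _ = a
... | no _  = f u

[≔]-same : ∀ {A : Set} (f : ℕ → A) x a → (f [ x ≔ a ]) x ≡ a
[≔]-same f x a with x ≟ x
... | yes _  = refl
... | no x≢x = ⊥-elim (x≢x refl)

[≔]-other : ∀ {A : Set} (f : ℕ → A) {x} a {u} → x ≢ u → (f [ x ≔ a ]) u ≡ f u
[≔]-other f {x} a {u} x≢u with u ≟ x
... | yes u≡x = ⊥-elim (x≢u (sym u≡x))
... | no _    = refl

[≔]-agreesOn : ∀ {A : Set} (f : ℕ → A) {x} a {xs} → All (x ≢_) xs →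
  All (λ u → f u ≡ (f [ x ≔ a ]) u) xs
[≔]-agreesOn f a = All.map (sym ∘ [≔]-other f a)

-- Coverings

Colour : Set
Colour = ℕ ⊎ ℕ

InPalette : ℕ → ℕ → Colour → Set
InPalette r s (inj₁ k) = k < r
InPalette r s (inj₂ k) = k < s

Compatible : Colour → Colour → ℕ → ℕ → Set
Compatible (inj₁ k) (inj₁ l) a b = k ≡ l → a < b
Compatible (inj₂ k) (inj₂ l) a b = k ≡ l → b < a
Compatible _        _        _ _ = ⊤

-- Colours are attached to letters rather than to positions, which is
-- harmless because the words we cover have distinct letters.
record Covering (r s : ℕ) (xs : List ℕ) : Set where
  field
    colour     : ℕ → Colour
    inPalette  : All (InPalette r s ∘ colour) xs
    compatible : AllPairs (λ a b → Compatible (colour a) (colour b) a b) xs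
open Covering

InPalette-mono : ∀ {r r′ s s′} → r ≤ r′ → s ≤ s′ → ∀ c → InPalette r s c → InPalette r′ s′ c
InPalette-mono r≤r′ _ (inj₁ k) k<r = <-≤-trans k<r r≤r′
InPalette-mono _ s≤s′ (inj₂ k) k<s = <-≤-trans k<s s≤s′

InPalette-0-0 : ∀ c → ¬ InPalette 0 0 c
InPalette-0-0 (inj₁ _) ()
InPalette-0-0 (inj₂ _) ()

fresh-compatibleˡ : ∀ {r s a b} c → InPalette r s c → Compatible (inj₂ s) c a b
fresh-compatibleˡ (inj₁ _) _        = tt
fresh-compatibleˡ (inj₂ _) k<s refl = ⊥-elim (<-irrefl refl k<s)

fresh-compatibleʳ : ∀ {r s a b} c → InPalette r s c → Compatible c (inj₂ s) a b
fresh-compatibleʳ (inj₁ _) _        = tt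
fresh-compatibleʳ (inj₂ _) k<s refl = ⊥-elim (<-irrefl refl k<s)

Covering-[] : ∀ {r s} → Covering r s []
Covering-[] = record { colour = λ _ → inj₁ 0 ; inPalette = [] ; compatible = [] }

¬Covering-0-0 : ∀ {x xs} → ¬ Covering 0 0 (x ∷ xs)
¬Covering-0-0 {x} cov = InPalette-0-0 (colour cov x) (All.head (inPalette cov))

Covering-monoˡ : ∀ {r r′ s xs} → r ≤ r′ → Covering r s xs → Covering r′ s xs
Covering-monoˡ r≤r′ cov = record
  { colour     = colour cov
  ; inPalette  = All.map (λ {u} → InPalette-mono r≤r′ ≤-refl (colour cov u)) (inPalette cov)
  ; compatible = compatible cov
  }

DecreasingOn : (ℕ → Bool) → List ℕ → Set
DecreasingOn P = AllPairs (λ a b → T (P a) → T (P b) → b < a)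

DecreasingOn-none : ∀ xs → DecreasingOn (λ _ → false) xs
DecreasingOn-none []       = []
DecreasingOn-none (_ ∷ xs) = All.tabulate (λ _ ()) ∷ DecreasingOn-none xs

withDecreasingClass : (ℕ → Bool) → ℕ → (ℕ → Colour) → ℕ → Colour
withDecreasingClass P s c u = if P u then inj₂ s else c u

module _ {r s : ℕ} (P : ℕ → Bool) (c : ℕ → Colour) where

  private
    c′ : ℕ → Colour
    c′ = withDecreasingClass P s c

    marked-first : ∀ {x b} → P x ≡ true → (T (P b) → b < x) →
      (T (not (P b)) → InPalette r s (c b)) → Compatible (c′ x) (c′ b) x b
    marked-first {x} {b} px b<x old rewrite px with P b
    ... | true  = λ _ → b<x tt
    ... | false = fresh-compatibleˡ (c b) (old tt)

    unmarked-first : ∀ {x b} → P x ≡ false → InPalette r s (c x) →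
      (T (not (P b)) → Compatible (c x) (c b) x b) → Compatible (c′ x) (c′ b) x b
    unmarked-first {x} {b} px inx old rewrite px with P b
    ... | true  = fresh-compatibleʳ (c x) inx
    ... | false = old tt

  withDecreasingClass-inPalette : ∀ u → (T (not (P u)) → InPalette r s (c u)) →
    InPalette r (suc s) (c′ u)
  withDecreasingClass-inPalette u old with P u
  ... | true  = n<1+n s
  ... | false = InPalette-mono ≤-refl (n≤1+n s) (c u) (old tt)

  withDecreasingClass-compatible : ∀ xs → DecreasingOn P xs →
    All (InPalette r s ∘ c) (filterᵇ (not ∘ P) xs) →
    AllPairs (λ a b → Compatible (c a) (c b) a b) (filterᵇ (not ∘ P) xs) →
    AllPairs (λ a b → Compatible (c′ a) (c′ b) a b) xs
  withDecreasingClass-compatible [] [] _ _ = []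
  withDecreasingClass-compatible (x ∷ xs) (dx ∷ dxs) pal cmp with P x in px
  ... | true  = All.zipWith (λ (b<x , old) → marked-first px (b<x tt) old)
                  (dx , All-filterᵇ⁻ (not ∘ P) xs pal)
                ∷ withDecreasingClass-compatible xs dxs pal cmp
  ... | false = All.map (unmarked-first px (All.head pal))
                  (All-filterᵇ⁻ (not ∘ P) xs (AllPairs.head cmp))
                ∷ withDecreasingClass-compatible xs dxs (All.tail pal) (AllPairs.tail cmp)

Covering-addDecreasing : ∀ {r s xs} P → DecreasingOn P xs →
  Covering r s (filterᵇ (not ∘ P) xs) → Covering r (suc s) xs
Covering-addDecreasing {s = s} {xs} P dec cov = record
  { colour     = withDecreasingClass P s (colour cov)
  ; inPalette  = All.map (λ {u} → withDecreasingClass-inPalette P (colour cov) u)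
                   (All-filterᵇ⁻ (not ∘ P) xs (inPalette cov))
  ; compatible = withDecreasingClass-compatible P (colour cov) xs dec (inPalette cov) (compatible cov)
  }

-- Mirsky's theorem

record DecreasingBelow (xs : List ℕ) (v len : ℕ) : Set where
  field
    marked     : ℕ → Bool
    decreasing : DecreasingOn marked xs
    below      : All (λ u → T (marked u) → u < v) xs
    long       : len ≤ length (filterᵇ marked xs)
open DecreasingBelow

DecreasingBelow-empty : ∀ xs v → DecreasingBelow xs v 0
DecreasingBelow-empty xs v = record
  { marked     = λ _ → false
  ; decreasing = DecreasingOn-none xs
  ; below      = All.tabulate (λ _ ())
  ; long       = z≤n
  }

DecreasingBelow-mono : ∀ {xs v w len} → v ≤ w → DecreasingBelow xs v len → DecreasingBelow xs w len
DecreasingBelow-mono v≤w D = record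
  { marked     = marked D
  ; decreasing = decreasing D
  ; below      = All.map (λ u<v m → <-≤-trans (u<v m) v≤w) (below D)
  ; long       = long D
  }

DecreasingBelow-skip : ∀ {x xs v len} → All (x ≢_) xs →
  DecreasingBelow xs v len → DecreasingBelow (x ∷ xs) v len
DecreasingBelow-skip {x} {xs} {v} {len} x∉ D = record
  { marked     = m′
  ; decreasing = All.tabulate (λ _ m′x → ⊥-elim (x-unmarked m′x))
                 ∷ AllPairs-congOn {R = λ p q a b → T p → T q → b < a} agree (decreasing D)
  ; below      = (⊥-elim ∘ x-unmarked) ∷ All-congOn {Q = λ p u → T p → u < v} agree (below D)
  ; long       = begin
      len                             ≤⟨ long D ⟩
      length (filterᵇ (marked D) xs)  ≡⟨ cong length (filterᵇ-congOn agree) ⟩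
      length (filterᵇ m′ xs)          ≡⟨ cong length (filter-reject (T? ∘ m′) {x} {xs} x-unmarked) ⟨
      length (filterᵇ m′ (x ∷ xs))    ∎
  }
  where
  open ≤-Reasoning
  m′ : ℕ → Bool
  m′ = marked D [ x ≔ false ]
  agree : All (λ u → marked D u ≡ m′ u) xs
  agree = [≔]-agreesOn (marked D) false x∉
  x-unmarked : ¬ T (m′ x)
  x-unmarked = subst T ([≔]-same (marked D) x false)

DecreasingBelow-cons : ∀ {x xs len} → All (x ≢_) xs →
  DecreasingBelow xs x len → DecreasingBelow (x ∷ xs) (suc x) (suc len)
DecreasingBelow-cons {x} {xs} {len} x∉ D = record
  { marked     = m′
  ; decreasing = All.map (λ b<x _ → b<x) below′
                 ∷ AllPairs-congOn {R = λ p q a b → T p → T q → b < a} agree (decreasing D)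
  ; below      = (λ _ → n<1+n x) ∷ All.map (λ b<x m → m<n⇒m<1+n (b<x m)) below′
  ; long       = begin
      suc len                               ≤⟨ s≤s (long D) ⟩
      suc (length (filterᵇ (marked D) xs))  ≡⟨ cong (suc ∘ length) (filterᵇ-congOn agree) ⟩
      suc (length (filterᵇ m′ xs))          ≡⟨ cong length (filter-accept (T? ∘ m′) {x} {xs} x-marked) ⟨
      length (filterᵇ m′ (x ∷ xs))          ∎
  }
  where
  open ≤-Reasoning
  m′ : ℕ → Bool
  m′ = marked D [ x ≔ true ]
  agree : All (λ u → marked D u ≡ m′ u) xs
  agree = [≔]-agreesOn (marked D) true x∉
  below′ : All (λ u → T (m′ u) → u < x) xs
  below′ = All-congOn {Q = λ p u → T p → u < x} agree (below D)
  x-marked : T (m′ x)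
  x-marked = subst T (sym ([≔]-same (marked D) x true)) tt

record Ranking (xs : List ℕ) : Set where
  field
    rank       : ℕ → ℕ
    increasing : AllPairs (λ a b → rank a ≡ rank b → a < b) xs
    witnessed  : All (λ v → DecreasingBelow xs (suc v) (suc (rank v))) xs
open Ranking

rank-bound : ∀ {xs} (R : Ranking xs) x →
  ∃ λ k → DecreasingBelow xs x k × All (λ b → b < x → rank R b < k) xs
rank-bound {xs} R x with maximiser (_<? x) (rank R) xs
... | inj₁ none = 0 , DecreasingBelow-empty xs x , All.map (λ b≮x b<x → ⊥-elim (b≮x b<x)) none
... | inj₂ (y , y∈ , y<x , max) =
  suc (rank R y) , DecreasingBelow-mono y<x (All.lookup (witnessed R) y∈) , All.map (s≤s ∘_) max

Ranking-cons : ∀ {x xs} → All (x ≢_) xs → Ranking xs → Ranking (x ∷ xs)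
Ranking-cons {x} {xs} x∉ R with rank-bound R x
... | k , D , dominated = record
  { rank       = rank′
  ; increasing = All.zipWith (λ (x≢b , dom) → x-first x≢b dom) (x∉ , dominated)
                 ∷ AllPairs-congOn {R = λ p q a b → p ≡ q → a < b} agree (increasing R)
  ; witnessed  = subst (λ k′ → DecreasingBelow (x ∷ xs) (suc x) (suc k′))
                   (sym ([≔]-same (rank R) x k)) (DecreasingBelow-cons x∉ D)
                 ∷ All.zipWith (λ (x≢v , Dv) → subst (λ k′ → DecreasingBelow (x ∷ xs) _ (suc k′))
                                   (sym ([≔]-other (rank R) k x≢v)) (DecreasingBelow-skip x∉ Dv))
                   (x∉ , witnessed R)
  }
  where
  rank′ : ℕ → ℕ
  rank′ = rank R [ x ≔ k ]
  agree : All (λ u → rank R u ≡ rank′ u) xs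
  agree = [≔]-agreesOn (rank R) k x∉
  x-first : ∀ {b} → x ≢ b → (b < x → rank R b < k) → rank′ x ≡ rank′ b → x < b
  x-first {b} x≢b dom same with b <? x
  ... | yes b<x = ⊥-elim (<-irrefl (sym k≡rb) (dom b<x))
    where
    k≡rb : k ≡ rank R b
    k≡rb = trans (sym ([≔]-same (rank R) x k)) (trans same ([≔]-other (rank R) k x≢b))
  ... | no b≮x  = ≤∧≢⇒< (≮⇒≥ b≮x) x≢b

ranking : ∀ xs → Unique xs → Ranking xs
ranking []       []         = record { rank = λ _ → 0 ; increasing = [] ; witnessed = [] }
ranking (x ∷ xs) (x∉ ∷ xs!) = Ranking-cons x∉ (ranking xs xs!)

Ranking-covering : ∀ {xs ℓ} (R : Ranking xs) → All (λ u → rank R u < ℓ) xs → Covering ℓ 0 xs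
Ranking-covering R ranks<ℓ =
  record { colour = inj₁ ∘ rank R ; inPalette = ranks<ℓ ; compatible = increasing R }

mirsky : ∀ {xs} → Ranking xs →
  ∃ λ P → DecreasingOn P xs × Covering (length (filterᵇ P xs)) 0 xs
mirsky {xs} R with maximiser (λ _ → yes tt) (rank R) xs
... | inj₁ none =
  (λ _ → false) , DecreasingOn-none xs , Ranking-covering R (All.map (λ ¬⊤ → ⊥-elim (¬⊤ tt)) none)
... | inj₂ (y , y∈ , _ , max) = marked D , decreasing D ,
  Ranking-covering R (All.map (λ ru≤ry → <-≤-trans (s≤s (ru≤ry tt)) (long D)) max)
  where
  D : DecreasingBelow xs (suc y) (suc (rank R y))
  D = All.lookup (witnessed R) y∈

-- Counting uncoverable pairs

zeroRow : List (ℕ × ℕ) → List ℕ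
zeroRow []                = []
zeroRow ((r , zero)  ∷ L) = r ∷ zeroRow L
zeroRow ((r , suc s) ∷ L) = zeroRow L

higherRows : List (ℕ × ℕ) → List (ℕ × ℕ)
higherRows []                = []
higherRows ((r , zero)  ∷ L) = higherRows L
higherRows ((r , suc s) ∷ L) = (r , s) ∷ higherRows L

length-rows : ∀ L → length (zeroRow L) + length (higherRows L) ≡ length L
length-rows []                = refl
length-rows ((r , zero)  ∷ L) = cong suc (length-rows L)
length-rows ((r , suc s) ∷ L) = trans (+-suc _ _) (cong suc (length-rows L))

All-zeroRow : ∀ {Q : ℕ × ℕ → Set} {L} → All Q L → All (λ r → Q (r , 0)) (zeroRow L)
All-zeroRow {L = []}              []       = []
All-zeroRow {L = (r , zero)  ∷ L} (q ∷ qs) = q ∷ All-zeroRow qs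
All-zeroRow {L = (r , suc s) ∷ L} (q ∷ qs) = All-zeroRow qs

All-higherRows : ∀ {Q : ℕ × ℕ → Set} {L} → All Q L → All (λ (r , s) → Q (r , suc s)) (higherRows L)
All-higherRows {L = []}              []       = []
All-higherRows {L = (r , zero)  ∷ L} (q ∷ qs) = All-higherRows qs
All-higherRows {L = (r , suc s) ∷ L} (q ∷ qs) = q ∷ All-higherRows qs

Unique-zeroRow : ∀ {L} → Unique L → Unique (zeroRow L)
Unique-zeroRow {[]}              []        = []
Unique-zeroRow {(r , zero)  ∷ L} (p∉ ∷ L!) =
  All.map (λ p≢q r≡r′ → p≢q (cong (_, 0) r≡r′)) (All-zeroRow p∉) ∷ Unique-zeroRow L!
Unique-zeroRow {(r , suc s) ∷ L} (_  ∷ L!) = Unique-zeroRow L!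

Unique-higherRows : ∀ {L} → Unique L → Unique (higherRows L)
Unique-higherRows {[]}              []        = []
Unique-higherRows {(r , zero)  ∷ L} (_  ∷ L!) = Unique-higherRows L!
Unique-higherRows {(r , suc s) ∷ L} (p∉ ∷ L!) =
  All.map (λ p≢q e → p≢q (cong (λ (r , s) → r , suc s) e)) (All-higherRows p∉)
  ∷ Unique-higherRows L!

NotCoverable : List ℕ → ℕ × ℕ → Set
NotCoverable xs (r , s) = ¬ Covering r s xs

length-notCoverable : ∀ xs → Unique xs → Acc _<_ (length xs) →
  ∀ L → Unique L → All (NotCoverable xs) L → length L ≤ length xs
length-notCoverable [] _ _ []      _ _          = z≤n
length-notCoverable [] _ _ (_ ∷ _) _ (¬cov ∷ _) = ⊥-elim (¬cov Covering-[])
length-notCoverable xs@(_ ∷ _) xs! (acc shorter) L L! ¬covs with mirsky (ranking xs xs!)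
... | P , dec , cov = begin
  length L                                   ≡⟨ length-rows L ⟨
  length (zeroRow L) + length (higherRows L) ≤⟨ +-mono-≤ zeroRow-bound higherRows-bound ⟩
  ℓ + length rest                            ≡⟨ length-filterᵇ-split P xs ⟩
  length xs                                  ∎
  where
  open ≤-Reasoning
  ℓ : ℕ
  ℓ = length (filterᵇ P xs)
  rest : List ℕ
  rest = filterᵇ (not ∘ P) xs
  zeroRow-bound : length (zeroRow L) ≤ ℓ
  zeroRow-bound = length-unique-bounded (Unique-zeroRow L!)
    (All.map (λ ¬cov → ≰⇒> (λ ℓ≤r → ¬cov (Covering-monoˡ ℓ≤r cov))) (All-zeroRow ¬covs))
  rest<xs : length rest < length xs
  rest<xs = subst (length rest <_) (length-filterᵇ-split P xs) (m<n+m (length rest)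
    (n≢0⇒n>0 (λ ℓ≡0 → ¬Covering-0-0 (subst (λ r → Covering r 0 xs) ℓ≡0 cov))))
  higherRows-bound : length (higherRows L) ≤ length rest
  higherRows-bound = length-notCoverable rest (Unique.filter⁺ (T? ∘ not ∘ P) xs!)
    (shorter rest<xs) (higherRows L) (Unique-higherRows L!)
    (All.map (λ ¬cov cov′ → ¬cov (Covering-addDecreasing P dec cov′)) (All-higherRows ¬covs))

-- Permutations as words

toFin : ∀ {r s} c → InPalette r s c → Fin r ⊎ Fin s
toFin (inj₁ k) k<r = inj₁ (fromℕ< k<r)
toFin (inj₂ k) k<s = inj₂ (fromℕ< k<s)

toFin-inj₁ : ∀ {r s} c (p : InPalette r s c) {k} → toFin c p ≡ inj₁ k → c ≡ inj₁ (toℕ k)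
toFin-inj₁ (inj₁ _) p refl = cong inj₁ (sym (toℕ-fromℕ< p))

toFin-inj₂ : ∀ {r s} c (p : InPalette r s c) {k} → toFin c p ≡ inj₂ k → c ≡ inj₂ (toℕ k)
toFin-inj₂ (inj₂ _) p refl = cong inj₂ (sym (toℕ-fromℕ< p))

word : ∀ {n} → Permutation′ n → List ℕ
word π = tabulate (toℕ ∘ (π ⟨$⟩ʳ_))

Unique-word : ∀ {n} (π : Permutation′ n) → Unique (word π)
Unique-word π = Unique.tabulate⁺ (λ e →
  trans (sym (inverseˡ π)) (trans (cong (π ⟨$⟩ˡ_) (toℕ-injective e)) (inverseˡ π)))

Covering⇒Coverable : ∀ {n r s} (π : Permutation′ n) → Covering r s (word π) → Coverable π r s
Covering⇒Coverable {n} {r} {s} π cov = c , increasingClasses , decreasingClasses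
  where
  f : Fin n → ℕ
  f = toℕ ∘ (π ⟨$⟩ʳ_)
  pal : ∀ i → InPalette r s (colour cov (f i))
  pal = tabulate⁻ (inPalette cov)
  c : Fin n → Fin r ⊎ Fin s
  c i = toFin (colour cov (f i)) (pal i)
  compat : ∀ {i j} → i Fin.< j → Compatible (colour cov (f i)) (colour cov (f j)) (f i) (f j)
  compat = AllPairs-tabulate⁻ (compatible cov)
  increasingClasses : ∀ i j k → c i ≡ inj₁ k → c j ≡ inj₁ k → i Fin.< j → f i < f j
  increasingClasses i j k ci cj i<j = subst₂ (λ c d → Compatible c d (f i) (f j))
    (toFin-inj₁ _ (pal i) ci) (toFin-inj₁ _ (pal j) cj) (compat i<j) refl
  decreasingClasses : ∀ i j k → c i ≡ inj₂ k → c j ≡ inj₂ k → i Fin.< j → f j < f i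
  decreasingClasses i j k ci cj i<j = subst₂ (λ c d → Compatible c d (f i) (f j))
    (toFin-inj₂ _ (pal i) ci) (toFin-inj₂ _ (pal j) cj) (compat i<j) refl

lemma2 : (n : ℕ) (π : Permutation′ n) (L : List (ℕ × ℕ)) →
    Unique L → All (InD π) L → length L ≤ n
lemma2 n π L L! inD = subst (length L ≤_) (length-tabulate _)
  (length-notCoverable (word π) (Unique-word π) (<-wellFounded _) L L!
    (All.map (λ { {r , s} notCoverable cov → notCoverable (Covering⇒Coverable π cov) }) inD))
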